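{- Let $p_1, p$ be distinct primes and $B_{p_1} \subseteq \mathbb{Z}_{p_1}$ a ball. There exist $N_0(B_{p_1}) \in \mathbb{N}$ and a constant $C = C(B_{p_1}) > 0$ such that for all $N \ge N_0(B_{p_1})$, \[ \sum_{\substack{n=1\\ p \nmid n}}^N \varphi_{B_{p_1}}(n) \ge C N^2. \]
   Context: $\mathbb{Z}_{p_1}$ is the ring of $p_1$-adic integers, with $\mathbb{Q} \subseteq \mathbb{Q}_{p_1}$. $\varphi_{B_{p_1}}(n) := \#\{a \in \mathbb{N} : \gcd(a,n) = 1,\ \tfrac{a}{n} \in [0,1] \cap B_{p_1}\}$, i.e. the number of reduced fractions with denominator $n$ lying in $[0,1]$ and in the $p_1$-adic ball $B_{p_1}$. -}

module Defs where

open import Data.Nat using (ℕ; zero; suc; _+_; _*_; _^_; _≤_; ∣_-_∣)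
open import Data.Nat.Divisibility using (_∣_; _∣?_)
open import Data.Nat.Coprimality using (Coprime; coprime?)
open import Data.List using (List; length; filter; upTo; map)
open import Data.Nat.ListAction using (sum)
open import Data.Product using (_×_)
open import Relation.Nullary using (¬_)
open import Relation.Nullary.Decidable using (Dec; _×-dec_; ¬?)
open import Data.Integer using (+_)
open import Data.Rational using (ℚ; _/_)

-- A ball in ℤ_{p₁} is  B(c, k) = c + p₁^k ℤ_{p₁}  = { x ∈ ℤ_{p₁} : |x - c|_{p₁} ≤ p₁^{-k} }.
-- Every ball in ℤ_{p₁} has this form with k : ℕ and a centre c : ℕ (c < p₁^k
-- may be assumed; the ball depends only on c mod p₁^k).
--
-- The reduced fraction a/n (gcd(a,n)=1, n ≥ 1) lies in B(c,k) iff
--   p₁ ∤ n  (so a/n ∈ ℤ_{p₁})  and  p₁^k ∣ (a - c·n)  (in ℤ),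
-- the latter since v_{p₁}(a/n - c) = v_{p₁}(a - c n) - v_{p₁}(n) = v_{p₁}(a - c n).
InBall : (p₁ k c a n : ℕ) → Set
InBall p₁ k c a n = (¬ (p₁ ∣ n)) × ((p₁ ^ k) ∣ ∣ a - c * n ∣)

Good : (p₁ k c n a : ℕ) → Set
Good p₁ k c n a = Coprime a n × InBall p₁ k c a n

good? : (p₁ k c n a : ℕ) → Dec (Good p₁ k c n a)
good? p₁ k c n a = coprime? a n ×-dec (¬? (p₁ ∣? n) ×-dec ((p₁ ^ k) ∣? ∣ a - c * n ∣))

-- φ_{B}(n) = #{ a ∈ ℕ : gcd(a,n)=1, a/n ∈ [0,1] ∩ B },  a/n ∈ [0,1] ⇔ a ∈ {0,…,n}.
φB : (p₁ k c n : ℕ) → ℕ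
φB p₁ k c n = length (filter (good? p₁ k c n) (upTo (suc n)))

sumφB : (p p₁ k c N : ℕ) → ℕ
sumφB p p₁ k c N =
  sum (map (φB p₁ k c) (filter (λ n → ¬? (p ∣? n)) (map suc (upTo N))))

toℚ : ℕ → ℚ
toℚ n = (+ n) / 1

{-# OPTIONS --safe #-}
-- Put M = p₁^k and L = 12·p·p₁^(k+1). Every n ≡ 1 (mod L) is prime to p and to p₁, and every
-- a ≡ c (mod M) satisfies p₁^k ∣ a − c·n, so φ_B(n) counts every such a ≤ n coprime to n.
-- With I ≈ N/(2L) we sieve the I² pairs (a_j, n_i) = (c + M j, 1 + L(I + i)), i, j < I:
-- a common divisor d > 1 of such a pair is at least 5 (as 12 ∣ L) and prime to L, so the
-- terms of either progression divisible by d are d apart and number at most I/d + 1.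
-- Hence at most Σ_{d ≥ 5} (I/d + 1)² ≤ I²/2 + O(L I) pairs are not coprime, at least I²/4
-- are, and the sum over n ≤ N with p ∤ n is at least I²/4 ≥ N²/(64 L²).
module Submission where

module FiniteSums where

  open import Data.Nat
  open import Data.Nat.Properties
  open import Data.List using (_∷_; filter; length; map; applyUpTo)
  open import Data.Nat.ListAction using (sum)
  open import Data.Sum using (inj₁; inj₂)
  open import Relation.Nullary using (Dec; yes; no; ¬_; contradiction)
  open import Relation.Unary using (Pred; Decidable)
  open import Relation.Binary.PropositionalEquality
  open import Algebra.Properties.CommutativeSemigroup +-commutativeSemigroup using (interchange)

  infix 10 ∑<
  ∑< : ℕ → (ℕ → ℕ) → ℕ
  ∑< zero    f = 0
  ∑< (suc n) f = ∑< n f + f n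

  syntax ∑< n (λ i → e) = ∑[ i < n ] e

  ∑-cong : ∀ {f g} n → (∀ i → i < n → f i ≡ g i) → ∑< n f ≡ ∑< n g
  ∑-cong zero    _   = refl
  ∑-cong (suc n) f≡g = cong₂ _+_ (∑-cong n λ i i<n → f≡g i (m<n⇒m<1+n i<n)) (f≡g n (n<1+n n))

  ∑-mono-≤ : ∀ {f g} n → (∀ i → i < n → f i ≤ g i) → ∑< n f ≤ ∑< n g
  ∑-mono-≤ zero    _   = z≤n
  ∑-mono-≤ (suc n) f≤g = +-mono-≤ (∑-mono-≤ n λ i i<n → f≤g i (m<n⇒m<1+n i<n)) (f≤g n (n<1+n n))

  ∑-zero : ∀ {f} n → (∀ i → i < n → f i ≡ 0) → ∑< n f ≡ 0
  ∑-zero zero    _   = refl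
  ∑-zero (suc n) f≡0 = cong₂ _+_ (∑-zero n λ i i<n → f≡0 i (m<n⇒m<1+n i<n)) (f≡0 n (n<1+n n))

  ∑-const : ∀ a n → ∑[ _ < n ] a ≡ n * a
  ∑-const a zero    = refl
  ∑-const a (suc n) = trans (cong (_+ a) (∑-const a n)) (+-comm (n * a) a)

  ∑-distrib-+ : ∀ f g n → ∑[ i < n ] (f i + g i) ≡ ∑< n f + ∑< n g
  ∑-distrib-+ f g zero    = refl
  ∑-distrib-+ f g (suc n) =
    trans (cong (_+ (f n + g n)) (∑-distrib-+ f g n)) (interchange (∑< n f) (∑< n g) (f n) (g n))

  ∑-distribˡ-* : ∀ a f n → ∑[ i < n ] (a * f i) ≡ a * ∑< n f
  ∑-distribˡ-* a f zero    = sym (*-zeroʳ a)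
  ∑-distribˡ-* a f (suc n) =
    trans (cong (_+ a * f n) (∑-distribˡ-* a f n)) (sym (*-distribˡ-+ a (∑< n f) (f n)))

  ∑-product : ∀ f g m n → ∑[ i < m ] ∑[ j < n ] (f i * g j) ≡ ∑< m f * ∑< n g
  ∑-product f g m n = begin
    ∑[ i < m ] ∑[ j < n ] (f i * g j)
      ≡⟨ ∑-cong m (λ i _ → trans (∑-distribˡ-* (f i) g n) (*-comm (f i) (∑< n g))) ⟩
    ∑[ i < m ] (∑< n g * f i)
      ≡⟨ ∑-distribˡ-* (∑< n g) f m ⟩
    ∑< n g * ∑< m f
      ≡⟨ *-comm (∑< n g) (∑< m f) ⟩
    ∑< m f * ∑< n g
      ∎
    where open ≡-Reasoning

  ∑-comm : ∀ (h : ℕ → ℕ → ℕ) m n → ∑[ i < m ] ∑[ j < n ] h i j ≡ ∑[ j < n ] ∑[ i < m ] h i j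
  ∑-comm h zero    n = sym (∑-zero n (λ _ _ → refl))
  ∑-comm h (suc m) n = trans (cong (_+ ∑< n (h m)) (∑-comm h m n))
                             (sym (∑-distrib-+ (λ j → ∑[ i < m ] h i j) (h m) n))

  ∑-sucˡ : ∀ f n → ∑< (suc n) f ≡ f 0 + ∑[ i < n ] f (suc i)
  ∑-sucˡ f zero    = +-comm 0 (f 0)
  ∑-sucˡ f (suc n) = trans (cong (_+ f (suc n)) (∑-sucˡ f n)) (+-assoc (f 0) _ _)

  ∑-split : ∀ f m n → ∑< (m + n) f ≡ ∑< m f + ∑[ i < n ] f (m + i)
  ∑-split f m zero    rewrite +-identityʳ m = sym (+-identityʳ _)
  ∑-split f m (suc n) rewrite +-suc m n | ∑-split f m n = +-assoc (∑< m f) _ _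

  ∑-range-mono : ∀ f {m n} → m ≤ n → ∑< m f ≤ ∑< n f
  ∑-range-mono f {m} {n} m≤n = begin
    ∑< m f                                 ≤⟨ m≤m+n _ _ ⟩
    ∑< m f + ∑[ i < n ∸ m ] f (m + i)      ≡⟨ ∑-split f m (n ∸ m) ⟨
    ∑< (m + (n ∸ m)) f                     ≡⟨ cong (λ k → ∑< k f) (m+[n∸m]≡n m≤n) ⟩
    ∑< n f                                 ∎
    where open ≤-Reasoning

  term≤∑ : ∀ f {i n} → i < n → f i ≤ ∑< n f
  term≤∑ f {i} {suc n} i<1+n with m<1+n⇒m<n∨m≡n i<1+n
  ... | inj₁ i<n  = ≤-trans (term≤∑ f i<n) (m≤m+n _ _)
  ... | inj₂ refl = m≤n+m _ _

  ∑-multiples≤∑ : ∀ f d .{{_ : NonZero d}} m → ∑[ j < m ] f (d * j) ≤ ∑< (m * d) f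
  ∑-multiples≤∑ f d zero    = z≤n
  ∑-multiples≤∑ f d (suc m) = begin
    ∑[ j < m ] f (d * j) + f (d * m)
      ≤⟨ +-monoˡ-≤ (f (d * m)) (∑-multiples≤∑ f d m) ⟩
    ∑< (m * d) f + f (d * m)
      ≡⟨ cong (λ x → ∑< (m * d) f + f x) d*m≡m*d+0 ⟩
    ∑< (m * d) f + f (m * d + 0)
      ≤⟨ +-monoʳ-≤ (∑< (m * d) f) (term≤∑ (λ i → f (m * d + i)) (>-nonZero⁻¹ d)) ⟩
    ∑< (m * d) f + ∑[ i < d ] f (m * d + i)
      ≡⟨ ∑-split f (m * d) d ⟨
    ∑< (m * d + d) f
      ≡⟨ cong (λ k → ∑< k f) (+-comm (m * d) d) ⟩
    ∑< (suc m * d) f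
      ∎
    where
    open ≤-Reasoning
    d*m≡m*d+0 : d * m ≡ m * d + 0
    d*m≡m*d+0 = trans (*-comm d m) (sym (+-identityʳ (m * d)))

  𝟙 : ∀ {p} {P : Set p} → Dec P → ℕ
  𝟙 (yes _) = 1
  𝟙 (no _)  = 0

  𝟙-yes : ∀ {p} {P : Set p} (P? : Dec P) → P → 𝟙 P? ≡ 1
  𝟙-yes (yes _) _  = refl
  𝟙-yes (no ¬p) p = contradiction p ¬p

  𝟙-no : ∀ {p} {P : Set p} (P? : Dec P) → ¬ P → 𝟙 P? ≡ 0
  𝟙-no (yes p) ¬p = contradiction p ¬p
  𝟙-no (no _)  _  = refl

  𝟙-mono : ∀ {p q} {P : Set p} {Q : Set q} → (P → Q) → (P? : Dec P) (Q? : Dec Q) → 𝟙 P? ≤ 𝟙 Q?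
  𝟙-mono P⇒Q (yes p) Q? = ≤-reflexive (sym (𝟙-yes Q? (P⇒Q p)))
  𝟙-mono P⇒Q (no _)  Q? = z≤n

  count : ∀ {p} {P : Pred ℕ p} → Decidable P → ℕ → ℕ
  count P? n = ∑[ x < n ] 𝟙 (P? x)

  module _ {p} {P : Pred ℕ p} (P? : Decidable P) where

    length-filter-∷ : ∀ x xs → length (filter P? (x ∷ xs)) ≡ 𝟙 (P? x) + length (filter P? xs)
    length-filter-∷ x xs with P? x
    ... | yes _ = refl
    ... | no _  = refl

    sum-map-filter-∷ : ∀ g x xs →
      sum (map g (filter P? (x ∷ xs))) ≡ 𝟙 (P? x) * g x + sum (map g (filter P? xs))
    sum-map-filter-∷ g x xs with P? x
    ... | yes _ = cong (_+ sum (map g (filter P? xs))) (sym (+-identityʳ (g x)))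
    ... | no _  = refl

    length-filter-applyUpTo : ∀ f n → length (filter P? (applyUpTo f n)) ≡ count (λ i → P? (f i)) n
    length-filter-applyUpTo f zero    = refl
    length-filter-applyUpTo f (suc n) = begin
      length (filter P? (f 0 ∷ applyUpTo (λ i → f (suc i)) n))
        ≡⟨ length-filter-∷ (f 0) _ ⟩
      𝟙 (P? (f 0)) + length (filter P? (applyUpTo (λ i → f (suc i)) n))
        ≡⟨ cong (𝟙 (P? (f 0)) +_) (length-filter-applyUpTo (λ i → f (suc i)) n) ⟩
      𝟙 (P? (f 0)) + count (λ i → P? (f (suc i))) n
        ≡⟨ ∑-sucˡ (λ i → 𝟙 (P? (f i))) n ⟨
      count (λ i → P? (f i)) (suc n)
        ∎
      where open ≡-Reasoning

    sum-map-filter-applyUpTo : ∀ g f n →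
      sum (map g (filter P? (applyUpTo f n))) ≡ ∑[ i < n ] (𝟙 (P? (f i)) * g (f i))
    sum-map-filter-applyUpTo g f zero    = refl
    sum-map-filter-applyUpTo g f (suc n) = begin
      sum (map g (filter P? (f 0 ∷ applyUpTo (λ i → f (suc i)) n)))
        ≡⟨ sum-map-filter-∷ g (f 0) _ ⟩
      𝟙 (P? (f 0)) * g (f 0) + sum (map g (filter P? (applyUpTo (λ i → f (suc i)) n)))
        ≡⟨ cong (𝟙 (P? (f 0)) * g (f 0) +_) (sum-map-filter-applyUpTo g (λ i → f (suc i)) n) ⟩
      𝟙 (P? (f 0)) * g (f 0) + ∑[ i < n ] (𝟙 (P? (f (suc i))) * g (f (suc i)))
        ≡⟨ ∑-sucˡ (λ i → 𝟙 (P? (f i)) * g (f i)) n ⟨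
      ∑[ i < suc n ] (𝟙 (P? (f i)) * g (f i))
        ∎
      where open ≡-Reasoning


module Sieve where

  open import Data.Nat
  open import Data.Nat.Properties
  open import Data.Nat.DivMod
  open import Data.Nat.Divisibility
  open import Data.Nat.GCD using (gcd; gcd[m,n]∣m; gcd[m,n]∣n)
  open import Data.Nat.Coprimality using (Coprime; coprime?; coprime-divisor; gcd≡1⇒coprime)
  open import Data.Nat.Tactic.RingSolver using (solve-∀)
  open import Data.Product using (_×_; _,_; proj₁; proj₂)
  open import Relation.Nullary using (yes; no; contradiction)
  open import Relation.Unary using (Pred; Decidable)
  open import Relation.Binary.PropositionalEquality
  open FiniteSums

  m<[1+m/n]*n : ∀ m n .{{_ : NonZero n}} → m < suc (m / n) * n
  m<[1+m/n]*n m n = begin-strict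
    m                 ≡⟨ m≡m%n+[m/n]*n m n ⟩
    m % n + m / n * n <⟨ +-monoˡ-< (m / n * n) (m%n<n m n) ⟩
    n + m / n * n     ∎
    where open ≤-Reasoning

  *≤⇒≤/ : ∀ {m n o} .{{_ : NonZero n}} → m * n ≤ o → m ≤ o / n
  *≤⇒≤/ {m} {n} m*n≤o = subst (_≤ _ / n) (m*n/n≡m m n) (/-monoˡ-≤ n m*n≤o)

  module _ {q} {Q : Pred ℕ q} (Q? : Decidable Q) (d : ℕ) .{{_ : NonZero d}}
           (spaced : ∀ {x y} → x < y → Q x → Q y → d ≤ y ∸ x) where

    count-window≤1 : ∀ s m → m ≤ d → count (λ x → Q? (s + x)) m ≤ 1
    count-window≤1 s zero    _   = z≤n
    count-window≤1 s (suc m) m<d with Q? (s + m)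
    ... | no _   = ≤-trans (≤-reflexive (+-identityʳ _)) (count-window≤1 s m (<⇒≤ m<d))
    ... | yes qm = ≤-reflexive (cong (_+ 1) (∑-zero m earlier-absent))
      where
      earlier-absent : ∀ x → x < m → 𝟙 (Q? (s + x)) ≡ 0
      earlier-absent x x<m = 𝟙-no (Q? (s + x)) λ qx →
        <⇒≱ m<d (≤-trans (subst (d ≤_) ([m+n]∸[m+o]≡n∸o s m x) (spaced (+-monoʳ-< s x<m) qx qm))
                         (m∸n≤m m x))

    count-blocks : ∀ b → count Q? (b * d) ≤ b
    count-blocks zero    = z≤n
    count-blocks (suc b) = begin
      count Q? (d + b * d)
        ≡⟨ cong (count Q?) (+-comm d (b * d)) ⟩
      count Q? (b * d + d)
        ≡⟨ ∑-split (λ x → 𝟙 (Q? x)) (b * d) d ⟩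
      count Q? (b * d) + count (λ x → Q? (b * d + x)) d
        ≤⟨ +-mono-≤ (count-blocks b) (count-window≤1 (b * d) d ≤-refl) ⟩
      b + 1
        ≡⟨ +-comm b 1 ⟩
      suc b
        ∎
      where open ≤-Reasoning

    count-spaced : ∀ I → count Q? I ≤ suc (I / d)
    count-spaced I = ≤-trans (∑-range-mono _ (<⇒≤ (m<[1+m/n]*n I d))) (count-blocks (suc (I / d)))

  ∣-affine-spaced : ∀ {d a b x y} → Coprime d a → x < y →
                    d ∣ b + a * x → d ∣ b + a * y → d ≤ y ∸ x
  ∣-affine-spaced {d} {a} {b} {x} {y} d⊥a x<y d∣b+ax d∣b+ay =
    ∣⇒≤ {{>-nonZero (m<n⇒0<n∸m x<y)}} (coprime-divisor d⊥a d∣a[y∸x])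
    where
    open ≡-Reasoning
    b+ay≡b+ax+a[y∸x] : b + a * y ≡ (b + a * x) + a * (y ∸ x)
    b+ay≡b+ax+a[y∸x] = begin
      b + a * y               ≡⟨ cong (λ z → b + a * z) (m+[n∸m]≡n (<⇒≤ x<y)) ⟨
      b + a * (x + (y ∸ x))   ≡⟨ cong (b +_) (*-distribˡ-+ a x (y ∸ x)) ⟩
      b + (a * x + a * (y ∸ x)) ≡⟨ +-assoc b (a * x) (a * (y ∸ x)) ⟨
      b + a * x + a * (y ∸ x) ∎
    d∣a[y∸x] : d ∣ a * (y ∸ x)
    d∣a[y∸x] = ∣m+n∣m⇒∣n (subst (d ∣_) b+ay≡b+ax+a[y∸x] d∣b+ay) d∣b+ax

  count-∣-affine : ∀ d .{{_ : NonZero d}} a b → Coprime d a →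
                   ∀ I → count (λ x → d ∣? b + a * x) I ≤ suc (I / d)
  count-∣-affine d a b d⊥a = count-spaced (λ x → d ∣? b + a * x) d (∣-affine-spaced d⊥a)

  -- (x / (d + 1))² ≤ x² / d − x² / (d + 1), up to rounding; summing telescopes.
  square-quotient-step : ∀ x d .{{_ : NonZero d}} →
    x / suc d * (x / suc d) + x * x / suc d ≤ x * x / d
  square-quotient-step x d = *≤⇒≤/ (begin
    (q * q + r) * d        ≡⟨ *-distribʳ-+ d (q * q) r ⟩
    q * q * d + r * d      ≤⟨ +-monoˡ-≤ (r * d) (*≤⇒≤/ q*q*d*[1+d]≤x*x) ⟩
    r + r * d              ≡⟨ *-suc r d ⟨
    r * suc d              ≤⟨ m/n*n≤m (x * x) (suc d) ⟩
    x * x                  ∎)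
    where
    open ≤-Reasoning
    q r : ℕ
    q = x / suc d
    r = x * x / suc d
    q*q*d*[1+d]≤x*x : q * q * d * suc d ≤ x * x
    q*q*d*[1+d]≤x*x = begin
      q * q * d * suc d             ≤⟨ *-monoˡ-≤ (suc d) (*-monoʳ-≤ (q * q) (n≤1+n d)) ⟩
      q * q * suc d * suc d         ≡⟨ regroup q (suc d) ⟩
      (q * suc d) * (q * suc d)     ≤⟨ *-mono-≤ (m/n*n≤m x (suc d)) (m/n*n≤m x (suc d)) ⟩
      x * x                         ∎
      where
      regroup : ∀ q e → q * q * e * e ≡ (q * e) * (q * e)
      regroup = solve-∀

  ∑-square-quotients : ∀ x D E →
    ∑[ e < E ] (x / suc (suc (D + e)) * (x / suc (suc (D + e)))) + x * x / suc (D + E) ≤ x * x / suc D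
  ∑-square-quotients x D zero    = ≤-reflexive (cong (λ k → x * x / suc k) (+-identityʳ D))
  ∑-square-quotients x D (suc E) = begin
    ∑< E t + t E + x * x / suc (D + suc E)
      ≡⟨ cong (λ k → ∑< E t + t E + x * x / suc k) (+-suc D E) ⟩
    ∑< E t + t E + x * x / suc (suc (D + E))
      ≡⟨ +-assoc (∑< E t) (t E) _ ⟩
    ∑< E t + (t E + x * x / suc (suc (D + E)))
      ≤⟨ +-monoʳ-≤ (∑< E t) (square-quotient-step x (suc (D + E))) ⟩
    ∑< E t + x * x / suc (D + E)
      ≤⟨ ∑-square-quotients x D E ⟩
    x * x / suc D
      ∎
    where
    open ≤-Reasoning
    t : ℕ → ℕ
    t e = x / suc (suc (D + e)) * (x / suc (suc (D + e)))

  [1+m]²≤2+2m² : ∀ m → suc m * suc m ≤ 2 + 2 * (m * m)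
  [1+m]²≤2+2m² zero    = s≤s z≤n
  [1+m]²≤2+2m² (suc m) = subst (suc (suc m) * suc (suc m) ≤_) (expand m) (m≤m+n _ (m * m))
    where
    expand : ∀ m → suc (suc m) * suc (suc m) + m * m ≡ 2 + 2 * (suc m * suc m)
    expand = solve-∀

  m≤n+o∧4o≤3m⇒m≤4n : ∀ {m n o} → m ≤ n + o → 4 * o ≤ 3 * m → m ≤ 4 * n
  m≤n+o∧4o≤3m⇒m≤4n {m} {n} {o} m≤n+o 4o≤3m = +-cancelʳ-≤ (3 * m) m (4 * n) (begin
    4 * m           ≤⟨ *-monoʳ-≤ 4 m≤n+o ⟩
    4 * (n + o)     ≡⟨ *-distribˡ-+ 4 n o ⟩
    4 * n + 4 * o   ≤⟨ +-monoʳ-≤ (4 * n) 4o≤3m ⟩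
    4 * n + 3 * m   ∎)
    where open ≤-Reasoning

  coprimePairs : (a n : ℕ → ℕ) → ℕ → ℕ
  coprimePairs a n I = ∑[ i < I ] ∑[ j < I ] 𝟙 (coprime? (a j) (n i))

  module _ (a n : ℕ → ℕ) (I D E : ℕ)
           (divisors-in-range : ∀ {i g} → i < I → g ∣ n i → g ≢ 1 → D ≤ g × g < D + E) where

    coprime-or-common-divisor : ∀ {i} j → i < I →
      1 ≤ 𝟙 (coprime? (a j) (n i)) + ∑[ e < E ] (𝟙 (D + e ∣? n i) * 𝟙 (D + e ∣? a j))
    coprime-or-common-divisor {i} j i<I with coprime? (a j) (n i)
    ... | yes _      = s≤s z≤n
    ... | no ¬coprime = ≤-trans (≤-reflexive (sym both-divisible)) (term≤∑ _ e<E)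
      where
      g : ℕ
      g = gcd (a j) (n i)
      D≤g×g<D+E : D ≤ g × g < D + E
      D≤g×g<D+E = divisors-in-range i<I (gcd[m,n]∣n (a j) (n i))
                                    (λ g≡1 → ¬coprime (gcd≡1⇒coprime g≡1))
      e : ℕ
      e = g ∸ D
      D+e≡g : D + e ≡ g
      D+e≡g = m+[n∸m]≡n (proj₁ D≤g×g<D+E)
      e<E : e < E
      e<E = +-cancelˡ-< D e E (subst (_< D + E) (sym D+e≡g) (proj₂ D≤g×g<D+E))
      both-divisible : 𝟙 (D + e ∣? n i) * 𝟙 (D + e ∣? a j) ≡ 1
      both-divisible = cong₂ _*_
        (𝟙-yes (D + e ∣? n i) (subst (_∣ n i) (sym D+e≡g) (gcd[m,n]∣n (a j) (n i))))
        (𝟙-yes (D + e ∣? a j) (subst (_∣ a j) (sym D+e≡g) (gcd[m,n]∣m (a j) (n i))))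

    coprimePairs-union-bound :
      I * I ≤ coprimePairs a n I
              + ∑[ e < E ] (count (λ i → D + e ∣? n i) I * count (λ j → D + e ∣? a j) I)
    coprimePairs-union-bound = begin
      I * I
        ≡⟨ trans (∑-product (λ _ → 1) (λ _ → 1) I I) (cong₂ _*_ ∑1≡I ∑1≡I) ⟨
      ∑[ i < I ] ∑[ j < I ] 1
        ≤⟨ ∑-mono-≤ I (λ i i<I → ∑-mono-≤ I (λ j _ → coprime-or-common-divisor j i<I)) ⟩
      ∑[ i < I ] ∑[ j < I ] (𝟙 (coprime? (a j) (n i)) + ∑[ e < E ] h i j e)
        ≡⟨ ∑-cong I (λ i _ → ∑-distrib-+ _ _ I) ⟩
      ∑[ i < I ] (∑[ j < I ] 𝟙 (coprime? (a j) (n i)) + ∑[ j < I ] ∑[ e < E ] h i j e)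
        ≡⟨ ∑-distrib-+ _ _ I ⟩
      coprimePairs a n I + ∑[ i < I ] ∑[ j < I ] ∑[ e < E ] h i j e
        ≡⟨ cong (coprimePairs a n I +_) regroup ⟩
      coprimePairs a n I + ∑[ e < E ] (count (λ i → D + e ∣? n i) I * count (λ j → D + e ∣? a j) I)
        ∎
      where
      open ≤-Reasoning
      ∑1≡I : ∑[ _ < I ] 1 ≡ I
      ∑1≡I = trans (∑-const 1 I) (*-identityʳ I)
      h : ℕ → ℕ → ℕ → ℕ
      h i j e = 𝟙 (D + e ∣? n i) * 𝟙 (D + e ∣? a j)
      regroup : ∑[ i < I ] ∑[ j < I ] ∑[ e < E ] h i j e
              ≡ ∑[ e < E ] (count (λ i → D + e ∣? n i) I * count (λ j → D + e ∣? a j) I)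
      regroup = begin-equality
        ∑[ i < I ] ∑[ j < I ] ∑[ e < E ] h i j e ≡⟨ ∑-cong I (λ i _ → ∑-comm (h i) I E) ⟩
        ∑[ i < I ] ∑[ e < E ] ∑[ j < I ] h i j e ≡⟨ ∑-comm (λ i e → ∑[ j < I ] h i j e) I E ⟩
        ∑[ e < E ] ∑[ i < I ] ∑[ j < I ] h i j e ≡⟨ ∑-cong E (λ e _ → ∑-product _ _ I I) ⟩
        ∑[ e < E ] (count (λ i → D + e ∣? n i) I * count (λ j → D + e ∣? a j) I) ∎

  ∣-suc-multiple⇒≡1 : ∀ {d m x} → d ∣ m → m ∣ x → d ∣ suc x → d ≡ 1
  ∣-suc-multiple⇒≡1 {d} {x = x} d∣m m∣x d∣1+x =
    ∣1⇒≡1 (∣m+n∣m⇒∣n (subst (d ∣_) (+-comm 1 x) d∣1+x) (∣-trans d∣m m∣x))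

  module Progressions (L M c I : ℕ) (12∣L : 12 ∣ L) (M∣L : M ∣ L) where

    a : ℕ → ℕ
    a j = c + M * j

    -- The offset L * I puts every a j with j < I below n i once c ≤ I and 2 M ≤ L.
    n : ℕ → ℕ
    n i = suc (L * I + L * i)

    E : ℕ
    E = L * I + L * I

    L∣n∸1 : ∀ i → L ∣ L * I + L * i
    L∣n∸1 i = ∣m∣n⇒∣m+n (m∣m*n I) (m∣m*n i)

    ∣L∧∣n⇒≡1 : ∀ {d} i → d ∣ L → d ∣ n i → d ≡ 1
    ∣L∧∣n⇒≡1 i d∣L = ∣-suc-multiple⇒≡1 d∣L (L∣n∸1 i)

    ∣n⇒coprimeToL : ∀ {d} i → d ∣ n i → Coprime d L
    ∣n⇒coprimeToL i d∣n (k∣d , k∣L) = ∣L∧∣n⇒≡1 i k∣L (∣-trans k∣d d∣n)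

    divisor-of-n≥5 : ∀ {g} i → g ∣ n i → g ≢ 1 → 5 ≤ g
    divisor-of-n≥5 {0} i 0∣n _ with () ← 0∣⇒≡0 0∣n
    divisor-of-n≥5 {1} i _ 1≢1 = contradiction refl 1≢1
    divisor-of-n≥5 {2} i 2∣n _ with () ← ∣L∧∣n⇒≡1 i (∣-trans (divides 6 refl) 12∣L) 2∣n
    divisor-of-n≥5 {3} i 3∣n _ with () ← ∣L∧∣n⇒≡1 i (∣-trans (divides 4 refl) 12∣L) 3∣n
    divisor-of-n≥5 {4} i 4∣n _ with () ← ∣L∧∣n⇒≡1 i (∣-trans (divides 3 refl) 12∣L) 4∣n
    divisor-of-n≥5 {suc (suc (suc (suc (suc _))))} _ _ _ = s≤s (s≤s (s≤s (s≤s (s≤s z≤n))))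

    divisors-of-n-in-range : ∀ {i g} → i < I → g ∣ n i → g ≢ 1 → 5 ≤ g × g < 5 + E
    divisors-of-n-in-range {i} {g} i<I g∣n g≢1 = divisor-of-n≥5 i g∣n g≢1 , (begin-strict
      g      ≤⟨ ∣⇒≤ g∣n ⟩
      n i    ≤⟨ s≤s (+-monoʳ-≤ (L * I) (*-monoʳ-≤ L (<⇒≤ i<I))) ⟩
      1 + E  <⟨ +-monoˡ-< E {1} {5} (s≤s (s≤s z≤n)) ⟩
      5 + E  ∎)
      where open ≤-Reasoning

    progression-counts≤ : ∀ d .{{_ : NonZero d}} →
      count (λ i → d ∣? n i) I * count (λ j → d ∣? a j) I ≤ 2 + 2 * (I / d * (I / d))
    progression-counts≤ d with coprime? d L
    ... | yes d⊥L = ≤-trans (*-mono-≤ (count-∣-affine d L (suc (L * I)) d⊥L I)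
                                      (count-∣-affine d M c d⊥M I))
                            ([1+m]²≤2+2m² (I / d))
      where
      d⊥M : Coprime d M
      d⊥M (k∣d , k∣M) = d⊥L (k∣d , ∣-trans k∣M M∣L)
    ... | no ¬d⊥L = ≤-trans (≤-reflexive (cong (_* count (λ j → d ∣? a j) I) no-multiples)) z≤n
      where
      no-multiples : count (λ i → d ∣? n i) I ≡ 0
      no-multiples = ∑-zero I (λ i _ → 𝟙-no (d ∣? n i) (λ d∣n → ¬d⊥L (∣n⇒coprimeToL i d∣n)))

    noncoprime-pairs≤ :
      ∑[ e < E ] (count (λ i → 5 + e ∣? n i) I * count (λ j → 5 + e ∣? a j) I) ≤ E * 2 + 2 * (I * I / 4)
    noncoprime-pairs≤ = begin
      ∑[ e < E ] (count (λ i → 5 + e ∣? n i) I * count (λ j → 5 + e ∣? a j) I)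
        ≤⟨ ∑-mono-≤ E (λ e _ → progression-counts≤ (5 + e)) ⟩
      ∑[ e < E ] (2 + 2 * sq e)
        ≡⟨ ∑-distrib-+ (λ _ → 2) (λ e → 2 * sq e) E ⟩
      ∑[ _ < E ] 2 + ∑[ e < E ] (2 * sq e)
        ≡⟨ cong₂ _+_ (∑-const 2 E) (∑-distribˡ-* 2 sq E) ⟩
      E * 2 + 2 * ∑< E sq
        ≤⟨ +-monoʳ-≤ (E * 2) (*-monoʳ-≤ 2 (m+n≤o⇒m≤o (∑< E sq) (∑-square-quotients I 3 E))) ⟩
      E * 2 + 2 * (I * I / 4)
        ∎
      where
      open ≤-Reasoning
      sq : ℕ → ℕ
      sq e = I / (5 + e) * (I / (5 + e))

    coprimePairs≥I²/4 : 16 * L ≤ I → I * I ≤ 4 * coprimePairs a n I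
    coprimePairs≥I²/4 16L≤I = m≤n+o∧4o≤3m⇒m≤4n {n = coprimePairs a n I} {E * 2 + 2 * (I * I / 4)}
      (≤-trans (coprimePairs-union-bound a n I 5 E divisors-of-n-in-range)
               (+-monoʳ-≤ (coprimePairs a n I) noncoprime-pairs≤))
      (begin
        4 * (E * 2 + 2 * (I * I / 4))
          ≡⟨ expand L I (I * I / 4) ⟩
        16 * L * I + 2 * (4 * (I * I / 4))
          ≤⟨ +-mono-≤ (*-monoˡ-≤ I 16L≤I) (*-monoʳ-≤ 2 4*[x/4]≤x) ⟩
        I * I + 2 * (I * I)
          ∎)
      where
      open ≤-Reasoning
      expand : ∀ L I q → 4 * ((L * I + L * I) * 2 + 2 * q) ≡ 16 * L * I + 2 * (4 * q)
      expand = solve-∀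
      4*[x/4]≤x : 4 * (I * I / 4) ≤ I * I
      4*[x/4]≤x = ≤-trans (≤-reflexive (*-comm 4 (I * I / 4))) (m/n*n≤m (I * I) 4)


module RationalScaling where

  open import Data.Nat as ℕ using (ℕ; suc)
  import Data.Nat.Properties as ℕ
  open import Relation.Binary.PropositionalEquality using (cong; sym)
  open import Data.Nat.Coprimality using (1-coprimeTo)
  open import Data.Integer as ℤ using (+_; +≤+)
  import Data.Integer.Properties as ℤ
  open import Data.Rational as ℚ using (ℚ; mkℚ; 0ℚ; toℚᵘ)
  open import Data.Rational.Properties
    using (toℚᵘ-cancel-≤; toℚᵘ-homo-*; toℚᵘ-fromℚᵘ; positive⁻¹)
  open import Data.Rational.Unnormalised as ℚᵘ using (mkℚᵘ; *≤*)
  import Data.Rational.Unnormalised.Properties as ℚᵘ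
  open import Defs using (toℚ)

  1/suc : ℕ → ℚ
  1/suc K = mkℚ (+ 1) K (1-coprimeTo (suc K))

  0<1/suc : ∀ K → 0ℚ ℚ.< 1/suc K
  0<1/suc K = positive⁻¹ (1/suc K)

  1/suc-scaling : ∀ K {x y} → x ℕ.≤ K ℕ.* y → 1/suc K ℚ.* toℚ x ℚ.≤ toℚ y
  1/suc-scaling K {x} {y} x≤Ky = toℚᵘ-cancel-≤ scaled
    where
    -- toℚ x = + x / 1 is definitionally fromℚᵘ (mkℚᵘ (+ x) 0).
    cross-multiplied : (+ 1 ℤ.* + x) ℤ.* + 1 ℤ.≤ + y ℤ.* + suc (K ℕ.* 1)
    cross-multiplied = begin
      (+ 1 ℤ.* + x) ℤ.* + 1    ≡⟨ ℤ.*-identityʳ (+ 1 ℤ.* + x) ⟩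
      + 1 ℤ.* + x              ≡⟨ ℤ.*-identityˡ (+ x) ⟩
      + x                      ≤⟨ +≤+ (ℕ.≤-trans x≤Ky (ℕ.m≤n+m (K ℕ.* y) y)) ⟩
      + (suc K ℕ.* y)          ≡⟨ cong +_ (ℕ.*-comm (suc K) y) ⟩
      + (y ℕ.* suc K)          ≡⟨ cong (λ z → + (y ℕ.* suc z)) (ℕ.*-identityʳ K) ⟨
      + (y ℕ.* suc (K ℕ.* 1))  ≡⟨ ℤ.pos-* y (suc (K ℕ.* 1)) ⟩
      + y ℤ.* + suc (K ℕ.* 1)  ∎
      where open ℤ.≤-Reasoning
    scaled : toℚᵘ (1/suc K ℚ.* toℚ x) ℚᵘ.≤ toℚᵘ (toℚ y)
    scaled = begin
      toℚᵘ (1/suc K ℚ.* toℚ x)        ≃⟨ toℚᵘ-homo-* (1/suc K) (toℚ x) ⟩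
      mkℚᵘ (+ 1) K ℚᵘ.* toℚᵘ (toℚ x)  ≃⟨ ℚᵘ.*-congˡ {mkℚᵘ (+ 1) K} (toℚᵘ-fromℚᵘ _) ⟩
      mkℚᵘ (+ 1) K ℚᵘ.* mkℚᵘ (+ x) 0  ≤⟨ *≤* cross-multiplied ⟩
      mkℚᵘ (+ y) 0                    ≃⟨ toℚᵘ-fromℚᵘ (mkℚᵘ (+ y) 0) ⟨
      toℚᵘ (toℚ y)                    ∎
      where open ℚᵘ.≤-Reasoning


module Ball where

  open import Data.Nat
  open import Data.Nat.Properties
  open import Data.Nat.DivMod
  open import Data.Nat.Divisibility
  open import Data.Nat.Coprimality using (Coprime; coprime?)
  open import Data.Nat.Primality using (Prime; prime⇒nonZero; ¬prime[1])
  open import Data.Nat.ListAction using (sum)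
  open import Data.Nat.Tactic.RingSolver using (solve-∀)
  open import Data.List using (filter; map)
  open import Data.List.Properties using (map-upTo)
  open import Data.Product using (_,_)
  open import Data.Sum using (inj₁; inj₂)
  open import Relation.Nullary using (¬_)
  open import Relation.Nullary.Decidable using (¬?)
  open import Relation.Binary.PropositionalEquality
  open import Defs
  open FiniteSums
  open Sieve

  ∣m∣n⇒∣m∸n : ∀ {d m n} → d ∣ m → d ∣ n → d ∣ m ∸ n
  ∣m∣n⇒∣m∸n (divides-refl p) (divides-refl q) = divides (p ∸ q) (sym (*-distribʳ-∸ _ p q))

  ∣m∣n⇒∣∣m-n∣ : ∀ {d m n} → d ∣ m → d ∣ n → d ∣ ∣ m - n ∣
  ∣m∣n⇒∣∣m-n∣ {d} {m} {n} d∣m d∣n with ∣m-n∣≡[m∸n]∨[n∸m] m n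
  ... | inj₁ ∣m-n∣≡m∸n = subst (d ∣_) (sym ∣m-n∣≡m∸n) (∣m∣n⇒∣m∸n d∣m d∣n)
  ... | inj₂ ∣m-n∣≡n∸m = subst (d ∣_) (sym ∣m-n∣≡n∸m) (∣m∣n⇒∣m∸n d∣n d∣m)

  φB≡count : ∀ p₁ k c n → φB p₁ k c n ≡ count (good? p₁ k c n) (suc n)
  φB≡count p₁ k c n = length-filter-applyUpTo (good? p₁ k c n) (λ x → x) (suc n)

  sumφB≡∑ : ∀ p p₁ k c N →
            sumφB p p₁ k c N ≡ ∑[ x < N ] (𝟙 (¬? (p ∣? suc x)) * φB p₁ k c (suc x))
  sumφB≡∑ p p₁ k c N = trans
    (cong (λ xs → sum (map (φB p₁ k c) (filter (λ m → ¬? (p ∣? m)) xs))) (map-upTo suc N))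
    (sum-map-filter-applyUpTo (λ m → ¬? (p ∣? m)) (φB p₁ k c) suc N)

  coprime⇒Good : ∀ {p₁ k c m x j} → p₁ ≢ 1 → p₁ ∣ m → p₁ ^ k ∣ m → m ∣ x →
    Coprime (c + p₁ ^ k * j) (suc x) → Good p₁ k c (suc x) (c + p₁ ^ k * j)
  coprime⇒Good {p₁} {k} {c} {m} {x} {j} p₁≢1 p₁∣m p₁^k∣m m∣x coprime =
    coprime , (λ p₁∣1+x → p₁≢1 (∣-suc-multiple⇒≡1 p₁∣m m∣x p₁∣1+x)) , p₁^k∣∣a-cn∣
    where
    ∣a-cn∣≡∣p₁^kj-cx∣ : ∣ c + p₁ ^ k * j - c * suc x ∣ ≡ ∣ p₁ ^ k * j - c * x ∣
    ∣a-cn∣≡∣p₁^kj-cx∣ = trans (cong (λ y → ∣ c + p₁ ^ k * j - y ∣) (*-suc c x))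
                              (∣m+n-m+o∣≡∣n-o∣ c (p₁ ^ k * j) (c * x))
    p₁^k∣∣a-cn∣ : p₁ ^ k ∣ ∣ c + p₁ ^ k * j - c * suc x ∣
    p₁^k∣∣a-cn∣ = subst (p₁ ^ k ∣_) (sym ∣a-cn∣≡∣p₁^kj-cx∣)
                    (∣m∣n⇒∣∣m-n∣ (m∣m*n j) (∣n⇒∣m*n c (∣-trans p₁^k∣m m∣x)))

  module QuadraticBound (p₁ p : ℕ) (p₁-prime : Prime p₁) (p-prime : Prime p) (k c : ℕ) where

    M : ℕ
    M = p₁ ^ k

    L : ℕ
    L = 12 * (p * (p₁ * M))

    instance
      p₁≢0 : NonZero p₁
      p₁≢0 = prime⇒nonZero p₁-prime
      p≢0 : NonZero p
      p≢0 = prime⇒nonZero p-prime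
      M≢0 : NonZero M
      M≢0 = m^n≢0 p₁ k
      L≢0 : NonZero L
      L≢0 = m*n≢0 12 (p * (p₁ * M)) {{_}} {{m*n≢0 p (p₁ * M) {{p≢0}} {{m*n≢0 p₁ M}}}}
      2L≢0 : NonZero (2 * L)
      2L≢0 = m*n≢0 2 L

    p₁≢1 : p₁ ≢ 1
    p₁≢1 p₁≡1 = ¬prime[1] (subst Prime p₁≡1 p₁-prime)

    p≢1 : p ≢ 1
    p≢1 p≡1 = ¬prime[1] (subst Prime p≡1 p-prime)

    12∣L : 12 ∣ L
    12∣L = m∣m*n (p * (p₁ * M))

    M∣L : M ∣ L
    M∣L = ∣n⇒∣m*n 12 (∣n⇒∣m*n p (n∣m*n p₁))

    p₁∣L : p₁ ∣ L
    p₁∣L = ∣n⇒∣m*n 12 (∣n⇒∣m*n p (m∣m*n M))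

    p∣L : p ∣ L
    p∣L = ∣n⇒∣m*n 12 (m∣m*n (p₁ * M))

    M+M≤L : M + M ≤ L
    M+M≤L = begin
      M + M                 ≤⟨ +-monoʳ-≤ M (m≤n*m M 11) ⟩
      M + 11 * M            ≤⟨ *-monoʳ-≤ 12 (≤-trans (m≤n*m M p₁) (m≤n*m (p₁ * M) p)) ⟩
      L                     ∎
      where open ≤-Reasoning

    module _ (I : ℕ) where

      open Progressions L M c I 12∣L M∣L

      coprime-row≤φB : c ≤ I → ∀ i → ∑[ j < I ] 𝟙 (coprime? (a j) (n i)) ≤ φB p₁ k c (n i)
      coprime-row≤φB c≤I i = begin
        ∑[ j < I ] 𝟙 (coprime? (a j) (n i))
          ≤⟨ ∑-mono-≤ I (λ j _ → coprime≤good j) ⟩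
        ∑[ j < I ] good (c + M * j)
          ≤⟨ ∑-multiples≤∑ (λ x → good (c + x)) M I ⟩
        ∑[ x < I * M ] good (c + x)
          ≤⟨ m≤n+m _ (∑< c good) ⟩
        ∑< c good + ∑[ x < I * M ] good (c + x)
          ≡⟨ ∑-split good c (I * M) ⟨
        ∑< (c + I * M) good
          ≤⟨ ∑-range-mono good a-range ⟩
        ∑< (suc (n i)) good
          ≡⟨ φB≡count p₁ k c (n i) ⟨
        φB p₁ k c (n i)
          ∎
        where
        open ≤-Reasoning
        good : ℕ → ℕ
        good x = 𝟙 (good? p₁ k c (n i) x)
        coprime≤good : ∀ j → 𝟙 (coprime? (a j) (n i)) ≤ good (a j)
        coprime≤good j = 𝟙-mono (coprime⇒Good {k = k} {c} {j = j} p₁≢1 p₁∣L M∣L (L∣n∸1 i)) _ _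
        a-range : c + I * M ≤ suc (n i)
        a-range = begin
          c + I * M      ≤⟨ +-monoˡ-≤ (I * M) (≤-trans c≤I (m≤m*n I M)) ⟩
          I * M + I * M  ≡⟨ *-distribˡ-+ I M M ⟨
          I * (M + M)    ≤⟨ *-monoʳ-≤ I M+M≤L ⟩
          I * L          ≡⟨ *-comm I L ⟩
          L * I          ≤⟨ m≤m+n (L * I) (L * i) ⟩
          L * I + L * i  <⟨ n<1+n _ ⟩
          n i            <⟨ n<1+n _ ⟩
          suc (n i)      ∎

      ∑φB[n]≤sumφB : ∀ N → I * (2 * L) ≤ N → ∑[ i < I ] φB p₁ k c (n i) ≤ sumφB p p₁ k c N
      ∑φB[n]≤sumφB N I*2L≤N = begin
        ∑[ i < I ] φB p₁ k c (n i)
          ≡⟨ ∑-cong I (λ i _ → F-at-n i) ⟨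
        ∑[ i < I ] F (L * (I + i))
          ≤⟨ m≤n+m _ _ ⟩
        ∑[ j < I ] F (L * j) + ∑[ i < I ] F (L * (I + i))
          ≡⟨ ∑-split (λ j → F (L * j)) I I ⟨
        ∑[ j < I + I ] F (L * j)
          ≤⟨ ∑-multiples≤∑ F L (I + I) ⟩
        ∑< ((I + I) * L) F
          ≤⟨ ∑-range-mono F (≤-trans (≤-reflexive (regroup I L)) I*2L≤N) ⟩
        ∑< N F
          ≡⟨ sumφB≡∑ p p₁ k c N ⟨
        sumφB p p₁ k c N
          ∎
        where
        open ≤-Reasoning
        regroup : ∀ I L → (I + I) * L ≡ I * (2 * L)
        regroup = solve-∀
        F : ℕ → ℕ
        F x = 𝟙 (¬? (p ∣? suc x)) * φB p₁ k c (suc x)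
        F-at-n : ∀ i → F (L * (I + i)) ≡ φB p₁ k c (n i)
        F-at-n i = begin-equality
          F (L * (I + i))      ≡⟨ cong F (*-distribˡ-+ L I i) ⟩
          F (L * I + L * i)    ≡⟨ cong (_* φB p₁ k c (n i)) (𝟙-yes (¬? (p ∣? n i)) p∤n) ⟩
          1 * φB p₁ k c (n i)  ≡⟨ *-identityˡ _ ⟩
          φB p₁ k c (n i)      ∎
          where
          p∤n : ¬ p ∣ n i
          p∤n p∣n = p≢1 (∣L∧∣n⇒≡1 i p∣L p∣n)

      I²≤4*sumφB : 16 * L ≤ I → c ≤ I → ∀ N → I * (2 * L) ≤ N → I * I ≤ 4 * sumφB p p₁ k c N
      I²≤4*sumφB 16L≤I c≤I N I*2L≤N = begin
        I * I                           ≤⟨ coprimePairs≥I²/4 16L≤I ⟩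
        4 * coprimePairs a n I          ≤⟨ *-monoʳ-≤ 4 (∑-mono-≤ I (λ i _ → coprime-row≤φB c≤I i)) ⟩
        4 * ∑[ i < I ] φB p₁ k c (n i)  ≤⟨ *-monoʳ-≤ 4 (∑φB[n]≤sumφB N I*2L≤N) ⟩
        4 * sumφB p p₁ k c N            ∎
        where open ≤-Reasoning

    N₀ : ℕ
    N₀ = (16 * L + c) * (2 * L)

    K : ℕ
    K = 64 * (L * L)

    sumφB-quadratic : ∀ N → N₀ ≤ N → N * N ≤ K * sumφB p p₁ k c N
    sumφB-quadratic N N₀≤N = begin
      N * N                          ≤⟨ *-mono-≤ N≤I*4L N≤I*4L ⟩
      (I * (4 * L)) * (I * (4 * L))  ≡⟨ square-regroup I L ⟩
      16 * (L * L) * (I * I)         ≤⟨ *-monoʳ-≤ (16 * (L * L)) I²≤4S ⟩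
      16 * (L * L) * (4 * S)         ≡⟨ constant-regroup (L * L) S ⟩
      K * S                          ∎
      where
      open ≤-Reasoning
      square-regroup : ∀ I L → (I * (4 * L)) * (I * (4 * L)) ≡ 16 * (L * L) * (I * I)
      square-regroup = solve-∀
      constant-regroup : ∀ l s → 16 * l * (4 * s) ≡ 64 * l * s
      constant-regroup = solve-∀
      S : ℕ
      S = sumφB p p₁ k c N
      I : ℕ
      I = N / (2 * L)
      16L+c≤I : 16 * L + c ≤ I
      16L+c≤I = *≤⇒≤/ N₀≤N
      16L≤I : 16 * L ≤ I
      16L≤I = m+n≤o⇒m≤o (16 * L) 16L+c≤I
      c≤I : c ≤ I
      c≤I = m+n≤o⇒n≤o (16 * L) 16L+c≤I
      1≤I : 1 ≤ I
      1≤I = ≤-trans (≤-trans (>-nonZero⁻¹ L) (m≤n*m L 16)) 16L≤I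
      I²≤4S : I * I ≤ 4 * S
      I²≤4S = I²≤4*sumφB I 16L≤I c≤I N (m/n*n≤m N (2 * L))
      double-regroup : ∀ I L → (I + I) * (2 * L) ≡ I * (4 * L)
      double-regroup = solve-∀
      N≤I*4L : N ≤ I * (4 * L)
      N≤I*4L = begin
        N                    <⟨ m<[1+m/n]*n N (2 * L) ⟩
        suc I * (2 * L)      ≤⟨ *-monoˡ-≤ (2 * L) (+-monoˡ-≤ I 1≤I) ⟩
        (I + I) * (2 * L)    ≡⟨ double-regroup I L ⟩
        I * (4 * L)          ∎



open import Defs
open import Data.Nat using (ℕ; _*_; _≥_)
open import Data.Nat.Primality using (Prime)
open import Data.Rational using (ℚ; 0ℚ; _<_; _≤_)
open import Data.Product using (Σ; _×_; _,_)
open import Relation.Binary.PropositionalEquality using (_≢_)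
import Data.Rational as Q
open RationalScaling using (1/suc; 0<1/suc; 1/suc-scaling)

mainTheorem11 : (p₁ p : ℕ) → Prime p₁ → Prime p → p₁ ≢ p →
    (k c : ℕ) →
    Σ ℕ (λ N₀ → Σ ℚ (λ C → (0ℚ < C) ×
      ((N : ℕ) → N ≥ N₀ →
        C Q.* toℚ (N * N) ≤ toℚ (sumφB p p₁ k c N))))
mainTheorem11 p₁ p p₁-prime p-prime _ k c =
  N₀ , 1/suc K , 0<1/suc K , λ N N≥N₀ → 1/suc-scaling K (sumφB-quadratic N N≥N₀)
  where open Ball.QuadraticBound p₁ p p₁-prime p-prime k c
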